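{- Let $L$ be a set of MSO sentences over $\{<,P_l,P_r\}$ containing only finitely many pairwise non-equivalent sentences, and with $\mathrm{Def}(L)\neq\emptyset$. Then $\mathrm{DN}(L)\le \mathrm{LS}(L)$ and $\mathrm{DN}(L)\le\mathrm{H}(L)$.
   Context: Words are nonempty finite words over $\Sigma=\{l,r\}$, identified with word models (positions with linear order $<$ and unary predicates $P_l,P_r$). A sentence $\phi$ defines a word $w$ if $w$ is the only word satisfying $\phi$; $\mathrm{Def}(L)$ is the set of words defined by some sentence of $L$ and $\mathrm{DN}(L)=\max\{|w|:w\in\mathrm{Def}(L)\}$. For a sentence $\phi$: $\mu(\phi)$ is the minimal length of a word satisfying $\phi$ ($0$ if none); $\nu(\phi)$ is the maximal length of a word satisfying $\phi$, with $\nu(\phi)=0$ if $\phi$ has no models or has arbitrarily long models. $\mathrm{LS}(L)=\max\{\mu(\phi):\phi\in L\}$ and $\mathrm{H}(L)=\max\{\nu(\phi):\phi\in L\}$. -}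

module Defs where

open import Data.Nat using (ℕ; zero; suc; _≤_; _≥_)
open import Data.Fin using (Fin)
open import Data.Fin.Subset using (Subset; _∈_)
open import Data.List using (List; length; lookup)
open import Data.List.NonEmpty using (List⁺; toList)
open import Data.List.Relation.Unary.All using (All)
open import Data.List.Relation.Unary.Any using (Any)
open import Data.Product using (Σ; _×_; ∃; ∃-syntax; _,_)
open import Data.Sum using (_⊎_)
open import Data.Empty using (⊥)
open import Relation.Nullary using (¬_)
open import Relation.Binary.PropositionalEquality using (_≡_)
import Data.Fin as F

data Letter : Set where
  l r : Letter

Word : Set
Word = List⁺ Letter

∣_∣ : Word → ℕ
∣ w ∣ = length (toList w)

Pos : Word → Set
Pos w = Fin ∣ w ∣

letterAt : (w : Word) → Pos w → Letter
letterAt w i = lookup (toList w) i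

extend : {A : Set} {m : ℕ} → A → (Fin m → A) → Fin (suc m) → A
extend a ρ F.zero    = a
extend a ρ (F.suc i) = ρ i

-- MSO formulas over {<, P_l, P_r} with m free first-order variables
-- and k free second-order (set) variables (de Bruijn indices).
data Formula (m k : ℕ) : Set where
  _<'_  : Fin m → Fin m → Formula m k
  _=='_ : Fin m → Fin m → Formula m k
  Pl Pr : Fin m → Formula m k
  _∈'_  : Fin m → Fin k → Formula m k
  ⊥'    : Formula m k
  ¬'_   : Formula m k → Formula m k
  _∧'_ _∨'_ _⇒'_ : Formula m k → Formula m k → Formula m k
  ∃₁ ∀₁ : Formula (suc m) k → Formula m k
  ∃₂ ∀₂ : Formula m (suc k) → Formula m k

Sentence : Set
Sentence = Formula 0 0

Sat : (w : Word) {m k : ℕ} → (Fin m → Pos w) → (Fin k → Subset ∣ w ∣) →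
      Formula m k → Set
Sat w ρ σ (x <' y)  = ρ x F.< ρ y
Sat w ρ σ (x ==' y) = ρ x ≡ ρ y
Sat w ρ σ (Pl x)    = letterAt w (ρ x) ≡ l
Sat w ρ σ (Pr x)    = letterAt w (ρ x) ≡ r
Sat w ρ σ (x ∈' X)  = ρ x ∈ σ X
Sat w ρ σ ⊥'        = ⊥
Sat w ρ σ (¬' φ)    = ¬ Sat w ρ σ φ
Sat w ρ σ (φ ∧' ψ)  = Sat w ρ σ φ × Sat w ρ σ ψ
Sat w ρ σ (φ ∨' ψ)  = Sat w ρ σ φ ⊎ Sat w ρ σ ψ
Sat w ρ σ (φ ⇒' ψ)  = Sat w ρ σ φ → Sat w ρ σ ψ
Sat w ρ σ (∃₁ φ)    = Σ (Pos w) λ p → Sat w (extend p ρ) σ φ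
Sat w ρ σ (∀₁ φ)    = (p : Pos w) → Sat w (extend p ρ) σ φ
Sat w ρ σ (∃₂ φ)    = Σ (Subset ∣ w ∣) λ S → Sat w ρ (extend S σ) φ
Sat w ρ σ (∀₂ φ)    = (S : Subset ∣ w ∣) → Sat w ρ (extend S σ) φ

noVars : {A : Set} → Fin 0 → A
noVars ()

_⊨_ : Word → Sentence → Set
w ⊨ φ = Sat w noVars noVars φ

Equiv : Sentence → Sentence → Set
Equiv φ ψ = (w : Word) → (w ⊨ φ → w ⊨ ψ) × (w ⊨ ψ → w ⊨ φ)

Defines : Sentence → Word → Set
Defines φ w = (w ⊨ φ) × ((v : Word) → v ⊨ φ → v ≡ w)

SentenceSet : Set₁
SentenceSet = Sentence → Set

InDef : SentenceSet → Word → Set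
InDef L w = ∃[ φ ] (L φ × Defines φ w)

FinitelyManyUpToEquiv : SentenceSet → Set
FinitelyManyUpToEquiv L =
  ∃[ reps ] (All L reps × ((φ : Sentence) → L φ → Any (Equiv φ) reps))

IsMu : Sentence → ℕ → Set
IsMu φ m =
  (((w : Word) → ¬ (w ⊨ φ)) × m ≡ 0)
  ⊎ ((∃[ w ] (w ⊨ φ × ∣ w ∣ ≡ m)) × ((w : Word) → w ⊨ φ → m ≤ ∣ w ∣))

Unbounded : Sentence → Set
Unbounded φ = (k : ℕ) → ∃[ w ] (w ⊨ φ × k ≤ ∣ w ∣)

IsNu : Sentence → ℕ → Set
IsNu φ n =
  ((((w : Word) → ¬ (w ⊨ φ)) ⊎ Unbounded φ) × n ≡ 0)
  ⊎ ((∃[ w ] (w ⊨ φ × ∣ w ∣ ≡ n)) × ((w : Word) → w ⊨ φ → ∣ w ∣ ≤ n))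

-- DN(L) ≤ LS(L): unfolded as  max{|w| : w ∈ Def L} ≤ max{μ(φ) : φ ∈ L},
-- i.e. every w ∈ Def(L) is bounded by μ(φ) for some φ ∈ L.
DN≤LS : SentenceSet → Set
DN≤LS L = (w : Word) → InDef L w → ∃[ φ ] (L φ × ∃[ m ] (IsMu φ m × ∣ w ∣ ≤ m))

DN≤H : SentenceSet → Set
DN≤H L = (w : Word) → InDef L w → ∃[ φ ] (L φ × ∃[ n ] (IsNu φ n × ∣ w ∣ ≤ n))

module Submission where

open import Defs
open import Data.Nat.Properties using (≤-refl; ≤-reflexive)
open import Data.Product using (_×_; ∃-syntax; _,_)
open import Data.Sum using (inj₂)
open import Relation.Binary.PropositionalEquality using (refl; cong; sym)

-- A sentence defining w has w as its only model, so μ(φ) = ν(φ) = |w|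
-- and each w ∈ Def(L) is bounded by its own defining sentence.

defines⇒isMu : ∀ {φ w} → Defines φ w → IsMu φ ∣ w ∣
defines⇒isMu {w = w} (w⊨φ , unique) =
  inj₂ ((w , w⊨φ , refl) , λ v v⊨φ → ≤-reflexive (cong ∣_∣ (sym (unique v v⊨φ))))

defines⇒isNu : ∀ {φ w} → Defines φ w → IsNu φ ∣ w ∣
defines⇒isNu {w = w} (w⊨φ , unique) =
  inj₂ ((w , w⊨φ , refl) , λ v v⊨φ → ≤-reflexive (cong ∣_∣ (unique v v⊨φ)))

dn≤ls : (L : SentenceSet) → DN≤LS L
dn≤ls L w (φ , Lφ , φ-defines-w) =
  φ , Lφ , ∣ w ∣ , defines⇒isMu φ-defines-w , ≤-refl

dn≤h : (L : SentenceSet) → DN≤H L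
dn≤h L w (φ , Lφ , φ-defines-w) =
  φ , Lφ , ∣ w ∣ , defines⇒isNu φ-defines-w , ≤-refl

-- The two hypotheses only ensure that the maxima DN, LS and H exist;
-- the unfolded inequalities hold for every L.
proposition1 : (L : SentenceSet) → FinitelyManyUpToEquiv L → ∃[ w ] InDef L w →
    DN≤LS L × DN≤H L
proposition1 L _ _ = dn≤ls L , dn≤h L
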